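{- Let $q\ge 2$, let $M=(m_{r,c})$ be the star matrix of a partition of ${\bf Z}_q^n$ into subcubes all of the same dimension, let $i\neq j$ be two columns of $M$, and let $\pi$ be a permutation of ${\bf Z}_q$. Let $R$ be the set of rows $r$ of $M$ such that both $m_{r,i}$ and $m_{r,j}$ lie in ${\bf Z}_q$. Then, as $r$ runs over $R$, the value $(m_{r,i}+\pi(m_{r,j}))\bmod q$ takes each value of ${\bf Z}_q$ the same number of times.
   Context: A subcube of ${\bf Z}_q^n$ is a set obtained by fixing some coordinates to given elements of ${\bf Z}_q$ and letting the others run over all of ${\bf Z}_q$; its dimension is the number of free coordinates. Its star pattern is the vector in $({\bf Z}_q\cup\{*\})^n$ whose $i$th entry is the fixed value of coordinate $i$ if fixed and $*$ otherwise. The star matrix of a partition of ${\bf Z}_q^n$ into subcubes is the matrix whose rows are the star patterns of the subcubes of the partition. Elements of ${\bf Z}_q$ are identified with $0,1,\dots,q-1$ and addition is modulo $q$. -}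

module Defs where

open import Data.Nat using (ℕ; _+_; _%_)
open import Data.Fin using (Fin; toℕ; fromℕ<)
open import Data.Maybe using (Maybe; just; nothing; is-nothing)
open import Data.Product using (Σ; _×_; _,_)
open import Data.Bool using (Bool; true; false)
open import Data.List using (List; length; filter)
open import Data.List using () renaming (allFin to allFinL)
import Data.Bool
import Data.Nat
open import Data.Fin.Permutation using (Permutation′; _⟨$⟩ʳ_)
open import Relation.Binary.PropositionalEquality using (_≡_)
open import Relation.Nullary using (Dec; yes; no; ¬_)
open import Relation.Unary using (Decidable)

-- A star pattern in (Z_q ∪ {*})^n: nothing = *, just v = coordinate fixed to v.
StarPattern : ℕ → ℕ → Set
StarPattern q n = Fin n → Maybe (Fin q)

_∈Cube_ : ∀ {q n} → (Fin n → Fin q) → StarPattern q n → Set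
x ∈Cube c = ∀ i v → c i ≡ just v → x i ≡ v

dim : ∀ {q n} → StarPattern q n → ℕ
dim {q} {n} c = length (filter (λ i → isStar (c i)) (allFinL n))
  where
  isStar : (m : Maybe (Fin q)) → Dec (is-nothing m ≡ true)
  isStar m = Data.Bool._≟_ (is-nothing m) true

StarMatrix : ℕ → ℕ → ℕ → Set
StarMatrix m q n = Fin m → StarPattern q n

IsPartition : ∀ {m q n} → StarMatrix m q n → Set
IsPartition {m} {q} {n} M =
  ∀ (x : Fin n → Fin q) →
    Σ (Fin m) λ r → (x ∈Cube M r) × (∀ r′ → x ∈Cube M r′ → r′ ≡ r)

SameDimension : ∀ {m q n} → StarMatrix m q n → Set
SameDimension {m} M = ∀ (r r′ : Fin m) → dim (M r) ≡ dim (M r′)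

hits : ∀ {q n} → Permutation′ q → (i j : Fin n) → Fin q → StarPattern q n → Bool
hits {q} π i j v c with c i | c j
... | just a | just b = Data.Nat._≡ᵇ_ (addMod q (toℕ a + toℕ (π ⟨$⟩ʳ b))) (toℕ v)
  where
  -- reduction modulo q (q = 0 cannot occur here since a : Fin q)
  addMod : ℕ → ℕ → ℕ
  addMod ℕ.zero    k = k
  addMod (ℕ.suc p) k = k % ℕ.suc p
... | _      | _      = false

count : ∀ {m q n} → StarMatrix m q n → Permutation′ q → (i j : Fin n) → Fin q → ℕ
count {m} M π i j v = length (filter (λ r → Data.Bool._≟_ (hits π i j v (M r)) true) (allFinL m))

-- Count the points x of Z_q^n with x_i + π(x_j) ≡ v (mod q).  Over the whole space this
-- number does not depend on v, because shifting x_i by 1 is a bijection that adds 1 to the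
-- residue.  Splitting the count along the partition, a subcube with a star in column i (or j)
-- also contributes independently of v, by the same shift in x_i (or the shift x_j ↦ π⁻¹(π x_j + 1)),
-- while a subcube with both entries fixed contributes q^d when its row hits v and 0 otherwise.
-- So (number of rows of R hitting v) · q^d is independent of v.
module Submission where

open import Defs
open import Data.Bool as Bool using (Bool; true; false; _∧_)
open import Data.Bool.Properties using (∧-conicalˡ; ∧-conicalʳ)
open import Data.Empty using (⊥-elim)
open import Data.Fin using (Fin; zero; suc; toℕ; inject₁; punchIn; _≟_)
open import Data.Fin.Induction using (<-weakInduction)
open import Data.Fin.Permutation
  using (Permutation′; _⟨$⟩ʳ_; _⟨$⟩ˡ_; permutation; inverseʳ; flip; _∘ₚ_)
open import Data.Fin.Properties
  using (toℕ-injective; toℕ-fromℕ<; toℕ-inject₁; toℕ<n; punchInᵢ≢i)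
open import Data.List using (length; filter; tabulate)
open import Data.Maybe using (Maybe; just; nothing; is-nothing)
open import Data.Nat using (ℕ; _+_; _*_; _^_; _%_; _≡ᵇ_; _≥_; NonZero)
open import Data.Nat.DivMod
  using (_mod_; m%n<n; %-distribˡ-+; m%n%n≡m%n; [m+n]%n≡m%n; m<n⇒m%n≡m; m≤n⇒m%n≡m)
open import Data.Nat.Properties
  using (+-*-semiring; +-comm; +-suc; +-identityʳ; *-identityʳ; *-zeroʳ; ^-distribˡ-+-*;
         +-cancelʳ-≡; *-cancelʳ-≡; m^n≢0)
  renaming (_≟_ to _≟ℕ_)
open import Data.Product using (∃-syntax; _,_; proj₁; proj₂)
open import Data.Sum using (_⊎_; inj₁; inj₂)
open import Data.Vec using (Vec; []; _∷_; lookup; updateAt)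
open import Data.Vec.Properties using (lookup∘updateAt; lookup∘updateAt′)
open import Function using (_∘_; _⇔_; mk⇔; Injection)
open import Function.Properties.Inverse using (↔⇒↣)
open import Relation.Binary.PropositionalEquality
open import Relation.Nullary using (does; yes)
open import Relation.Nullary.Decidable using (does-⇔; dec-true; dec-false)
open import Algebra.Properties.Semiring.Sum +-*-semiring
  using (sum; sum-syntax; sum-cong-≗; sum-remove; sum-replicate-zero; ∑-comm; ∑-permute;
         ∑-distrib-+; *-distribˡ-sum; *-distribʳ-sum)

𝟙 : Bool → ℕ
𝟙 true  = 1
𝟙 false = 0

𝟙-∧ : ∀ a b → 𝟙 (a ∧ b) ≡ 𝟙 a * 𝟙 b
𝟙-∧ true  b = sym (+-identityʳ (𝟙 b))
𝟙-∧ false b = refl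

length-filter-tabulate : ∀ {k} {A : Set} (b : A → Bool) (f : Fin k → A) →
  length (filter (λ a → b a Bool.≟ true) (tabulate f)) ≡ ∑[ r < k ] 𝟙 (b (f r))
length-filter-tabulate {ℕ.zero}  b f = refl
length-filter-tabulate {ℕ.suc k} b f with b (f zero)
... | true  = cong ℕ.suc (length-filter-tabulate b (f ∘ suc))
... | false = length-filter-tabulate b (f ∘ suc)

∑-const : ∀ k c → ∑[ _ < k ] c ≡ k * c
∑-const ℕ.zero    c = refl
∑-const (ℕ.suc k) c = cong (c +_) (∑-const k c)

sum-single : ∀ {k} (f : Fin k → ℕ) (v : Fin k) → (∀ a → a ≢ v → f a ≡ 0) → sum f ≡ f v
sum-single {ℕ.suc k} f v vanish = begin
  sum f                             ≡⟨ sum-remove {i = v} f ⟩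
  f v + ∑[ a < k ] f (punchIn v a)  ≡⟨ cong (f v +_) (sum-cong-≗ (λ a → vanish _ (punchInᵢ≢i v a))) ⟩
  f v + ∑[ a < k ] 0                ≡⟨ cong (f v +_) (sum-replicate-zero k) ⟩
  f v + 0                           ≡⟨ +-identityʳ (f v) ⟩
  f v                               ∎
  where open ≡-Reasoning

-- Points of Z_q^n are vectors rather than functions Fin n → Fin q, so that summing over
-- Z_q^n is an iterated sum over the coordinates and needs no function extensionality.
module _ {q : ℕ} where

  ∑ⱽ : ∀ {n} → (Vec (Fin q) n → ℕ) → ℕ
  ∑ⱽ {ℕ.zero}  g = g []
  ∑ⱽ {ℕ.suc n} g = ∑[ a < q ] ∑ⱽ (λ x → g (a ∷ x))

  ∑ⱽ-cong : ∀ {n} {g h : Vec (Fin q) n → ℕ} → (∀ x → g x ≡ h x) → ∑ⱽ g ≡ ∑ⱽ h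
  ∑ⱽ-cong {ℕ.zero}  g≗h = g≗h []
  ∑ⱽ-cong {ℕ.suc n} g≗h = sum-cong-≗ (λ a → ∑ⱽ-cong (λ x → g≗h (a ∷ x)))

  *-distribˡ-∑ⱽ : ∀ {n} c (g : Vec (Fin q) n → ℕ) → c * ∑ⱽ g ≡ ∑ⱽ (λ x → c * g x)
  *-distribˡ-∑ⱽ {ℕ.zero}  c g = refl
  *-distribˡ-∑ⱽ {ℕ.suc n} c g =
    trans (*-distribˡ-sum c (λ a → ∑ⱽ (λ x → g (a ∷ x))))
          (sum-cong-≗ (λ a → *-distribˡ-∑ⱽ c (λ x → g (a ∷ x))))

  ∑ⱽ-∑-comm : ∀ {n m} (g : Fin m → Vec (Fin q) n → ℕ) →
    ∑ⱽ (λ x → ∑[ r < m ] g r x) ≡ ∑[ r < m ] ∑ⱽ (g r)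
  ∑ⱽ-∑-comm {ℕ.zero}  g = refl
  ∑ⱽ-∑-comm {ℕ.suc n} g =
    trans (sum-cong-≗ (λ a → ∑ⱽ-∑-comm (λ r x → g r (a ∷ x))))
          (∑-comm (λ a r → ∑ⱽ (λ x → g r (a ∷ x))))

  ∑ⱽ-updateAt : ∀ {n} (k : Fin n) (τ : Permutation′ q) (g : Vec (Fin q) n → ℕ) →
    ∑ⱽ g ≡ ∑ⱽ (λ x → g (updateAt x k (τ ⟨$⟩ʳ_)))
  ∑ⱽ-updateAt zero    τ g = ∑-permute (λ a → ∑ⱽ (λ x → g (a ∷ x))) τ
  ∑ⱽ-updateAt (suc k) τ g = sum-cong-≗ (λ a → ∑ⱽ-updateAt k τ (λ x → g (a ∷ x)))

  matches : Maybe (Fin q) → Fin q → Bool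
  matches nothing  a = true
  matches (just v) a = does (a ≟ v)

  inCube : ∀ {n} → StarPattern q n → Vec (Fin q) n → Bool
  inCube {ℕ.zero}  c []      = true
  inCube {ℕ.suc n} c (a ∷ x) = matches (c zero) a ∧ inCube (c ∘ suc) x

  matches-sound : ∀ m a → matches m a ≡ true → ∀ v → m ≡ just v → a ≡ v
  matches-sound (just v) a a∈v .v refl with a ≟ v
  ... | yes a≡v = a≡v

  matches-complete : ∀ m a → (∀ v → m ≡ just v → a ≡ v) → matches m a ≡ true
  matches-complete nothing  a a∈m = refl
  matches-complete (just v) a a∈m = dec-true (a ≟ v) (a∈m v refl)

  inCube-sound : ∀ {n} (c : StarPattern q n) x → inCube c x ≡ true → lookup x ∈Cube c
  inCube-sound c (a ∷ x) x∈c zero    = matches-sound (c zero) a (∧-conicalˡ _ _ x∈c)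
  inCube-sound c (a ∷ x) x∈c (suc k) = inCube-sound (c ∘ suc) x (∧-conicalʳ _ _ x∈c) k

  inCube-complete : ∀ {n} (c : StarPattern q n) x → lookup x ∈Cube c → inCube c x ≡ true
  inCube-complete c []      x∈c = refl
  inCube-complete c (a ∷ x) x∈c =
    cong₂ _∧_ (matches-complete (c zero) a (x∈c zero)) (inCube-complete (c ∘ suc) x (x∈c ∘ suc))

  inCube-updateAt : ∀ {n} (c : StarPattern q n) k f x → c k ≡ nothing →
    inCube c (updateAt x k f) ≡ inCube c x
  inCube-updateAt c zero    f (a ∷ x) ck rewrite ck = refl
  inCube-updateAt c (suc k) f (a ∷ x) ck =
    cong (matches (c zero) a ∧_) (inCube-updateAt (c ∘ suc) k f x ck)

  ∑-matches : ∀ m → ∑[ a < q ] 𝟙 (matches m a) ≡ q ^ 𝟙 (is-nothing m)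
  ∑-matches nothing  = ∑-const q 1
  ∑-matches (just v) =
    trans (sum-single _ v (λ a a≢v → cong 𝟙 (dec-false (a ≟ v) a≢v)))
          (cong 𝟙 (dec-true (v ≟ v) refl))

  ∑ⱽ-inCube : ∀ {n} (c : StarPattern q n) → ∑ⱽ (𝟙 ∘ inCube c) ≡ q ^ ∑[ k < n ] 𝟙 (is-nothing (c k))
  ∑ⱽ-inCube {ℕ.zero}  c = refl
  ∑ⱽ-inCube {ℕ.suc n} c = begin
    ∑[ a < q ] ∑ⱽ (λ x → 𝟙 (matches c₀ a ∧ inCube c′ x))
      ≡⟨ sum-cong-≗ (λ a → ∑ⱽ-cong (λ x → 𝟙-∧ (matches c₀ a) (inCube c′ x))) ⟩
    ∑[ a < q ] ∑ⱽ (λ x → 𝟙 (matches c₀ a) * 𝟙 (inCube c′ x))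
      ≡⟨ sum-cong-≗ (λ a → *-distribˡ-∑ⱽ (𝟙 (matches c₀ a)) (𝟙 ∘ inCube c′)) ⟨
    ∑[ a < q ] (𝟙 (matches c₀ a) * ∑ⱽ (𝟙 ∘ inCube c′))
      ≡⟨ *-distribʳ-sum (∑ⱽ (𝟙 ∘ inCube c′)) (𝟙 ∘ matches c₀) ⟨
    ∑[ a < q ] 𝟙 (matches c₀ a) * ∑ⱽ (𝟙 ∘ inCube c′)
      ≡⟨ cong₂ _*_ (∑-matches c₀) (∑ⱽ-inCube c′) ⟩
    q ^ 𝟙 (is-nothing c₀) * q ^ ∑[ k < n ] 𝟙 (is-nothing (c′ k))
      ≡⟨ ^-distribˡ-+-* q (𝟙 (is-nothing c₀)) (∑[ k < n ] 𝟙 (is-nothing (c′ k))) ⟨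
    q ^ ∑[ k < ℕ.suc n ] 𝟙 (is-nothing (c k)) ∎
    where
    open ≡-Reasoning
    c₀ : Maybe (Fin q)
    c₀ = c zero
    c′ : StarPattern q n
    c′ = c ∘ suc

  cube-size : ∀ {n} (c : StarPattern q n) → ∑ⱽ (𝟙 ∘ inCube c) ≡ q ^ dim c
  cube-size c =
    trans (∑ⱽ-inCube c) (cong (q ^_) (sym (length-filter-tabulate (is-nothing ∘ c) (λ k → k))))

  inCube-partition : ∀ {m n} {M : StarMatrix m q n} → IsPartition M →
    ∀ x → ∑[ r < m ] 𝟙 (inCube (M r) x) ≡ 1
  inCube-partition {M = M} partition x with partition (lookup x)
  ... | r₀ , x∈r₀ , unique =
    trans (sum-single _ r₀ outside) (cong 𝟙 (inCube-complete (M r₀) x x∈r₀))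
    where
    outside : ∀ r → r ≢ r₀ → 𝟙 (inCube (M r) x) ≡ 0
    outside r r≢r₀ with inCube (M r) x in x∈r
    ... | true  = ⊥-elim (r≢r₀ (unique r (inCube-sound (M r) x x∈r)))
    ... | false = refl

module _ {q n : ℕ} where

  fiberWeight : (Vec (Fin q) n → Fin q) → (Vec (Fin q) n → ℕ) → Fin q → ℕ
  fiberWeight G h v = ∑ⱽ (λ x → h x * 𝟙 (does (G x ≟ v)))

  fiberWeight-cong : ∀ G {h h′} → (∀ x → h x ≡ h′ x) →
    ∀ v → fiberWeight G h v ≡ fiberWeight G h′ v
  fiberWeight-cong G h≗h′ v = ∑ⱽ-cong (λ x → cong (_* 𝟙 (does (G x ≟ v))) (h≗h′ x))

  fiberWeight-∑ : ∀ {m} G (h : Fin m → Vec (Fin q) n → ℕ) v →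
    fiberWeight G (λ x → ∑[ r < m ] h r x) v ≡ ∑[ r < m ] fiberWeight G (h r) v
  fiberWeight-∑ G h v =
    trans (∑ⱽ-cong (λ x → *-distribʳ-sum (𝟙 (does (G x ≟ v))) (λ r → h r x)))
          (∑ⱽ-∑-comm (λ r x → h r x * 𝟙 (does (G x ≟ v))))

  fiberWeight-equivariant : ∀ G h (k : Fin n) (τ ρ : Permutation′ q) →
    (∀ x → h (updateAt x k (τ ⟨$⟩ʳ_)) ≡ h x) →
    (∀ x → G (updateAt x k (τ ⟨$⟩ʳ_)) ≡ ρ ⟨$⟩ʳ G x) →
    ∀ v → fiberWeight G h (ρ ⟨$⟩ʳ v) ≡ fiberWeight G h v
  fiberWeight-equivariant G h k τ ρ hτ Gτ v =
    trans (∑ⱽ-updateAt k τ _) (∑ⱽ-cong (λ x → cong₂ (λ w b → w * 𝟙 b) (hτ x) (begin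
      does (G (updateAt x k (τ ⟨$⟩ʳ_)) ≟ ρ ⟨$⟩ʳ v) ≡⟨ cong (λ g → does (g ≟ ρ ⟨$⟩ʳ v)) (Gτ x) ⟩
      does (ρ ⟨$⟩ʳ G x ≟ ρ ⟨$⟩ʳ v)                 ≡⟨ does-⇔ ρ-injective (ρ ⟨$⟩ʳ G x ≟ ρ ⟨$⟩ʳ v) (G x ≟ v) ⟩
      does (G x ≟ v)                               ∎)))
    where
    open ≡-Reasoning
    ρ-injective : ∀ {a b} → ρ ⟨$⟩ʳ a ≡ ρ ⟨$⟩ʳ b ⇔ a ≡ b
    ρ-injective = mk⇔ (Injection.injective (↔⇒↣ ρ)) (cong (ρ ⟨$⟩ʳ_))

[m%d+n]%d≡[m+n]%d : ∀ m n d .{{_ : NonZero d}} → (m % d + n) % d ≡ (m + n) % d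
[m%d+n]%d≡[m+n]%d m n d = begin
  (m % d + n) % d         ≡⟨ %-distribˡ-+ (m % d) n d ⟩
  (m % d % d + n % d) % d ≡⟨ cong (λ k → (k + n % d) % d) (m%n%n≡m%n m d) ⟩
  (m % d + n % d) % d     ≡⟨ %-distribˡ-+ m n d ⟨
  (m + n) % d             ∎
  where open ≡-Reasoning

[m+n%d]%d≡[m+n]%d : ∀ m n d .{{_ : NonZero d}} → (m + n % d) % d ≡ (m + n) % d
[m+n%d]%d≡[m+n]%d m n d = begin
  (m + n % d) % d ≡⟨ cong (_% d) (+-comm m (n % d)) ⟩
  (n % d + m) % d ≡⟨ [m%d+n]%d≡[m+n]%d n m d ⟩
  (n + m) % d     ≡⟨ cong (_% d) (+-comm n m) ⟩
  (m + n) % d     ∎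
  where open ≡-Reasoning

module _ {p : ℕ} where

  private
    q : ℕ
    q = ℕ.suc p

  toℕ-mod : ∀ m → toℕ (m mod q) ≡ m % q
  toℕ-mod m = toℕ-fromℕ< (m%n<n m q)

  mod-cong : ∀ m m′ → m % q ≡ m′ % q → m mod q ≡ m′ mod q
  mod-cong m m′ eq = toℕ-injective (trans (toℕ-mod m) (trans eq (sym (toℕ-mod m′))))

  [a+q]%q≡a : ∀ (a : Fin q) → (toℕ a + q) % q ≡ toℕ a
  [a+q]%q≡a a = trans ([m+n]%n≡m%n (toℕ a) q) (m<n⇒m%n≡m (toℕ<n a))

  does-mod-≟ : ∀ m (v : Fin q) → does (m mod q ≟ v) ≡ (m % q ≡ᵇ toℕ v)
  does-mod-≟ m v = does-⇔
    (mk⇔ (λ e → trans (sym (toℕ-mod m)) (cong toℕ e)) (λ e → toℕ-injective (trans (toℕ-mod m) e)))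
    (m mod q ≟ v) (m % q ≟ℕ toℕ v)

  rot : Permutation′ q
  rot = permutation (λ a → ℕ.suc (toℕ a) mod q) (λ a → (toℕ a + p) mod q) rot∘rot⁻¹ rot⁻¹∘rot
    where
    open ≡-Reasoning
    rot∘rot⁻¹ : ∀ a → ℕ.suc (toℕ ((toℕ a + p) mod q)) mod q ≡ a
    rot∘rot⁻¹ a = toℕ-injective (begin
      toℕ (ℕ.suc (toℕ ((toℕ a + p) mod q)) mod q) ≡⟨ toℕ-mod (ℕ.suc (toℕ ((toℕ a + p) mod q))) ⟩
      (1 + toℕ ((toℕ a + p) mod q)) % q            ≡⟨ cong (λ k → (1 + k) % q) (toℕ-mod (toℕ a + p)) ⟩
      (1 + (toℕ a + p) % q) % q                    ≡⟨ [m+n%d]%d≡[m+n]%d 1 (toℕ a + p) q ⟩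
      ℕ.suc (toℕ a + p) % q                        ≡⟨ cong (_% q) (+-suc (toℕ a) p) ⟨
      (toℕ a + q) % q                              ≡⟨ [a+q]%q≡a a ⟩
      toℕ a                                        ∎)
    rot⁻¹∘rot : ∀ a → (toℕ (ℕ.suc (toℕ a) mod q) + p) mod q ≡ a
    rot⁻¹∘rot a = toℕ-injective (begin
      toℕ ((toℕ (ℕ.suc (toℕ a) mod q) + p) mod q) ≡⟨ toℕ-mod (toℕ (ℕ.suc (toℕ a) mod q) + p) ⟩
      (toℕ (ℕ.suc (toℕ a) mod q) + p) % q         ≡⟨ cong (λ k → (k + p) % q) (toℕ-mod (ℕ.suc (toℕ a))) ⟩
      (ℕ.suc (toℕ a) % q + p) % q                  ≡⟨ [m%d+n]%d≡[m+n]%d (ℕ.suc (toℕ a)) p q ⟩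
      ℕ.suc (toℕ a + p) % q                        ≡⟨ cong (_% q) (+-suc (toℕ a) p) ⟨
      (toℕ a + q) % q                              ≡⟨ [a+q]%q≡a a ⟩
      toℕ a                                        ∎)

  rot-inject₁ : ∀ (a : Fin p) → rot ⟨$⟩ʳ inject₁ a ≡ suc a
  rot-inject₁ a = toℕ-injective (begin
    toℕ (rot ⟨$⟩ʳ inject₁ a)     ≡⟨ toℕ-mod (ℕ.suc (toℕ (inject₁ a))) ⟩
    ℕ.suc (toℕ (inject₁ a)) % q ≡⟨ cong (λ k → ℕ.suc k % q) (toℕ-inject₁ a) ⟩
    ℕ.suc (toℕ a) % q           ≡⟨ m≤n⇒m%n≡m (toℕ<n a) ⟩
    ℕ.suc (toℕ a)               ∎)
    where open ≡-Reasoning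

  rot-mod : ∀ m → rot ⟨$⟩ʳ (m mod q) ≡ ℕ.suc m mod q
  rot-mod m = mod-cong (ℕ.suc (toℕ (m mod q))) (ℕ.suc m) (begin
    ℕ.suc (toℕ (m mod q)) % q ≡⟨ cong (λ k → (1 + k) % q) (toℕ-mod m) ⟩
    (1 + m % q) % q           ≡⟨ [m+n%d]%d≡[m+n]%d 1 m q ⟩
    ℕ.suc m % q               ∎)
    where open ≡-Reasoning

  fiberWeight-constant : ∀ {n} G h (k : Fin n) (τ : Permutation′ q) →
    (∀ x → h (updateAt x k (τ ⟨$⟩ʳ_)) ≡ h x) →
    (∀ x → G (updateAt x k (τ ⟨$⟩ʳ_)) ≡ rot ⟨$⟩ʳ G x) →
    ∀ v → fiberWeight G h v ≡ fiberWeight G h zero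
  fiberWeight-constant G h k τ hτ Gτ =
    <-weakInduction (λ v → fiberWeight G h v ≡ fiberWeight G h zero) refl λ a ih →
      trans (cong (fiberWeight G h) (sym (rot-inject₁ a)))
            (trans (fiberWeight-equivariant G h k τ rot hτ Gτ (inject₁ a)) ih)

module Residue {p n : ℕ} (i j : Fin n) (i≢j : i ≢ j) (π : Permutation′ (ℕ.suc p)) where

  private
    q : ℕ
    q = ℕ.suc p

  residue : Vec (Fin q) n → Fin q
  residue x = (toℕ (lookup x i) + toℕ (π ⟨$⟩ʳ lookup x j)) mod q

  residue-rotᵢ : ∀ x → residue (updateAt x i (rot ⟨$⟩ʳ_)) ≡ rot ⟨$⟩ʳ residue x
  residue-rotᵢ x = begin
    residue (updateAt x i (rot ⟨$⟩ʳ_))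
      ≡⟨ cong₂ (λ a b → (toℕ a + toℕ (π ⟨$⟩ʳ b)) mod q)
               (lookup∘updateAt i x) (lookup∘updateAt′ j i (i≢j ∘ sym) x) ⟩
    (toℕ (rot ⟨$⟩ʳ a) + b) mod q    ≡⟨ mod-cong (toℕ (rot ⟨$⟩ʳ a) + b) (ℕ.suc (toℕ a + b)) (begin
      (toℕ (rot ⟨$⟩ʳ a) + b) % q    ≡⟨ cong (λ k → (k + b) % q) (toℕ-mod {p} (ℕ.suc (toℕ a))) ⟩
      (ℕ.suc (toℕ a) % q + b) % q   ≡⟨ [m%d+n]%d≡[m+n]%d (ℕ.suc (toℕ a)) b q ⟩
      ℕ.suc (toℕ a + b) % q         ∎) ⟩
    ℕ.suc (toℕ a + b) mod q         ≡⟨ rot-mod (toℕ a + b) ⟨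
    rot ⟨$⟩ʳ residue x              ∎
    where
    open ≡-Reasoning
    a : Fin q
    a = lookup x i
    b : ℕ
    b = toℕ (π ⟨$⟩ʳ lookup x j)

  π-rot : Permutation′ q
  π-rot = π ∘ₚ rot ∘ₚ flip π

  residue-rotⱼ : ∀ x → residue (updateAt x j (π-rot ⟨$⟩ʳ_)) ≡ rot ⟨$⟩ʳ residue x
  residue-rotⱼ x = begin
    residue (updateAt x j (π-rot ⟨$⟩ʳ_))
      ≡⟨ cong₂ (λ a b → (toℕ a + toℕ (π ⟨$⟩ʳ b)) mod q)
               (lookup∘updateAt′ i j i≢j x) (lookup∘updateAt j x) ⟩
    (a + toℕ (π ⟨$⟩ʳ (π ⟨$⟩ˡ (rot ⟨$⟩ʳ b)))) mod q
      ≡⟨ cong (λ c → (a + toℕ c) mod q) (inverseʳ π) ⟩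
    (a + toℕ (rot ⟨$⟩ʳ b)) mod q    ≡⟨ mod-cong (a + toℕ (rot ⟨$⟩ʳ b)) (ℕ.suc (a + toℕ b)) (begin
      (a + toℕ (rot ⟨$⟩ʳ b)) % q    ≡⟨ cong (λ k → (a + k) % q) (toℕ-mod {p} (ℕ.suc (toℕ b))) ⟩
      (a + ℕ.suc (toℕ b) % q) % q   ≡⟨ [m+n%d]%d≡[m+n]%d a (ℕ.suc (toℕ b)) q ⟩
      (a + ℕ.suc (toℕ b)) % q       ≡⟨ cong (_% q) (+-suc a (toℕ b)) ⟩
      ℕ.suc (a + toℕ b) % q         ∎) ⟩
    ℕ.suc (a + toℕ b) mod q         ≡⟨ rot-mod (a + toℕ b) ⟨
    rot ⟨$⟩ʳ residue x              ∎
    where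
    open ≡-Reasoning
    a : ℕ
    a = toℕ (lookup x i)
    b : Fin q
    b = π ⟨$⟩ʳ lookup x j

  residue-inCube : ∀ c {a b} x → c i ≡ just a → c j ≡ just b → inCube c x ≡ true →
    residue x ≡ (toℕ a + toℕ (π ⟨$⟩ʳ b)) mod q
  residue-inCube c x ci cj x∈c = cong₂ (λ a b → (toℕ a + toℕ (π ⟨$⟩ʳ b)) mod q)
    (inCube-sound c x x∈c i _ ci) (inCube-sound c x x∈c j _ cj)

  cubeFiber : StarPattern q n → Fin q → ℕ
  cubeFiber c = fiberWeight residue (𝟙 ∘ inCube c)

  cubeFiber-constant : ∀ c → c i ≡ nothing ⊎ c j ≡ nothing →
    ∀ v → cubeFiber c v ≡ cubeFiber c zero
  cubeFiber-constant c (inj₁ ci) = fiberWeight-constant residue (𝟙 ∘ inCube c) i rot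
    (λ x → cong 𝟙 (inCube-updateAt c i _ x ci)) residue-rotᵢ
  cubeFiber-constant c (inj₂ cj) = fiberWeight-constant residue (𝟙 ∘ inCube c) j π-rot
    (λ x → cong 𝟙 (inCube-updateAt c j _ x cj)) residue-rotⱼ

  cubeFiber-fixed : ∀ c {a b} → c i ≡ just a → c j ≡ just b → ∀ v →
    cubeFiber c v ≡ 𝟙 (does ((toℕ a + toℕ (π ⟨$⟩ʳ b)) mod q ≟ v)) * ∑ⱽ (𝟙 ∘ inCube c)
  cubeFiber-fixed c {a} {b} ci cj v =
    trans (∑ⱽ-cong pointwise) (sym (*-distribˡ-∑ⱽ hit (𝟙 ∘ inCube c)))
    where
    hit : ℕ
    hit = 𝟙 (does ((toℕ a + toℕ (π ⟨$⟩ʳ b)) mod q ≟ v))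
    pointwise : ∀ x → 𝟙 (inCube c x) * 𝟙 (does (residue x ≟ v)) ≡ hit * 𝟙 (inCube c x)
    pointwise x with inCube c x in x∈c
    ... | false = sym (*-zeroʳ hit)
    ... | true  = trans (+-identityʳ _)
      (trans (cong (λ y → 𝟙 (does (y ≟ v))) (residue-inCube c x ci cj x∈c)) (sym (*-identityʳ hit)))

  cubeFiber-decomposition : ∀ c →
    ∃[ z ] ∀ v → cubeFiber c v ≡ 𝟙 (hits π i j v c) * ∑ⱽ (𝟙 ∘ inCube c) + z
  cubeFiber-decomposition c with c i in ci | c j in cj
  ... | nothing | _       = cubeFiber c zero , cubeFiber-constant c (inj₁ ci)
  ... | just a  | nothing = cubeFiber c zero , cubeFiber-constant c (inj₂ cj)
  ... | just a  | just b  = 0 , λ v → begin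
    cubeFiber c v
      ≡⟨ cubeFiber-fixed c ci cj v ⟩
    𝟙 (does ((toℕ a + toℕ (π ⟨$⟩ʳ b)) mod q ≟ v)) * ∑ⱽ (𝟙 ∘ inCube c)
      ≡⟨ cong (λ t → 𝟙 t * ∑ⱽ (𝟙 ∘ inCube c)) (does-mod-≟ (toℕ a + toℕ (π ⟨$⟩ʳ b)) v) ⟩
    𝟙 ((toℕ a + toℕ (π ⟨$⟩ʳ b)) % q ≡ᵇ toℕ v) * ∑ⱽ (𝟙 ∘ inCube c)
      ≡⟨ +-identityʳ _ ⟨
    𝟙 ((toℕ a + toℕ (π ⟨$⟩ʳ b)) % q ≡ᵇ toℕ v) * ∑ⱽ (𝟙 ∘ inCube c) + 0 ∎
    where open ≡-Reasoning

  fiberSize : Fin q → ℕ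
  fiberSize = fiberWeight residue (λ _ → 1)

  fiberSize-constant : ∀ v → fiberSize v ≡ fiberSize zero
  fiberSize-constant = fiberWeight-constant residue (λ _ → 1) i rot (λ _ → refl) residue-rotᵢ

  fiberSize-decomposition : ∀ {m} {M : StarMatrix m q n} → IsPartition M →
    ∀ {s} → (∀ r → ∑ⱽ (𝟙 ∘ inCube (M r)) ≡ s) →
    ∃[ z ] ∀ v → fiberSize v ≡ count M π i j v * s + z
  fiberSize-decomposition {m} {M} partition {s} size = ∑[ r < m ] z r , λ v → begin
    fiberSize v
      ≡⟨ fiberWeight-cong residue (sym ∘ inCube-partition partition) v ⟩
    fiberWeight residue (λ x → ∑[ r < m ] 𝟙 (inCube (M r) x)) v
      ≡⟨ fiberWeight-∑ residue (λ r → 𝟙 ∘ inCube (M r)) v ⟩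
    ∑[ r < m ] cubeFiber (M r) v
      ≡⟨ sum-cong-≗ (λ r → trans (proj₂ (cubeFiber-decomposition (M r)) v)
                                  (cong (λ t → hit v r * t + z r) (size r))) ⟩
    ∑[ r < m ] (hit v r * s + z r)
      ≡⟨ ∑-distrib-+ (λ r → hit v r * s) z ⟩
    ∑[ r < m ] (hit v r * s) + ∑[ r < m ] z r
      ≡⟨ cong (_+ ∑[ r < m ] z r) (*-distribʳ-sum s (hit v)) ⟨
    ∑[ r < m ] hit v r * s + ∑[ r < m ] z r
      ≡⟨ cong (λ t → t * s + ∑[ r < m ] z r) (length-filter-tabulate (hit′ v) (λ r → r)) ⟨
    count M π i j v * s + ∑[ r < m ] z r ∎
    where
    open ≡-Reasoning
    hit′ : Fin q → Fin m → Bool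
    hit′ v r = hits π i j v (M r)
    hit : Fin q → Fin m → ℕ
    hit v r = 𝟙 (hit′ v r)
    z : Fin m → ℕ
    z r = proj₁ (cubeFiber-decomposition (M r))

  count-constant : ∀ {m} {M : StarMatrix m q n} → IsPartition M → SameDimension M →
    ∀ v → count M π i j v ≡ count M π i j zero
  count-constant {M = M} partition same v =
    *-cancelʳ-≡ _ _ (q ^ d) {{m^n≢0 q d}} (+-cancelʳ-≡ z _ _ (begin
      count M π i j v * q ^ d + z    ≡⟨ fiberSize≡ v ⟨
      fiberSize v                        ≡⟨ fiberSize-constant v ⟩
      fiberSize zero                     ≡⟨ fiberSize≡ zero ⟩
      count M π i j zero * q ^ d + z ∎))
    where
    open ≡-Reasoning
    -- Z_q^n is nonempty, so the partition has a row, whose dimension is the common one.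
    d : ℕ
    d = dim (M (proj₁ (partition (λ _ → zero))))
    decomposition : ∃[ z ] ∀ v → fiberSize v ≡ count M π i j v * q ^ d + z
    decomposition = fiberSize-decomposition partition
      (λ r → trans (cube-size (M r)) (cong (q ^_) (same r _)))
    z : ℕ
    z = proj₁ decomposition
    fiberSize≡ : ∀ v → fiberSize v ≡ count M π i j v * q ^ d + z
    fiberSize≡ = proj₂ decomposition

lemma3 : (q n m : ℕ) → q ≥ 2 → (M : StarMatrix m q n) →
    IsPartition M → SameDimension M →
    (i j : Fin n) → i ≢ j → (π : Permutation′ q) →
    (v w : Fin q) → count M π i j v ≡ count M π i j w
lemma3 ℕ.zero    n m () M partition same i j i≢j π v w
lemma3 (ℕ.suc p) n m _  M partition same i j i≢j π v w =
  trans (count-constant partition same v) (sym (count-constant partition same w))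
  where open Residue i j i≢j π
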